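{- Let $T$ be a string of length $n \ge 1$ and let $[p,q]$ be an interval with $1 \le p \le q \le n$. Then $|\mathsf{SUPS}_T([p,q])| \le 4$. Moreover, this bound is tight: there exist a string $S$ and an interval $[p,q]$ such that $|\mathsf{SUPS}_S([p,q])| = 4$.
   Context: For a string $T$, $T[i..j]$ denotes the substring from position $i$ to position $j$ (1-indexed). A string $P$ is a palindrome if it equals its reversal. A string $w$ is unique in $T$ if it occurs exactly once in $T$; the empty string is by convention not unique. A substring occurrence $T[i..j]$ is a shortest unique palindromic substring (SUPS) for an interval $[p,q]$ if $T[i..j]$ is a palindrome, $T[i..j]$ is unique in $T$, $[p,q] \subseteq [i,j]$, and no shorter palindromic substring occurrence $T[i'..j']$ with $[p,q]\subseteq[i',j']$ is unique in $T$. $\mathsf{SUPS}_T([p,q])$ denotes the set of (occurrence intervals $[i,j]$ of) SUPSs for $[p,q]$ in $T$. -}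

module Defs where

open import Data.Nat using (ℕ; suc; _∸_; _+_; _≤_; _<_)
open import Data.List using (List; []; _∷_; take; drop; length; reverse)
open import Data.List.Relation.Unary.All using (All)
open import Data.List.Relation.Unary.Unique.Propositional using (Unique)
open import Data.List.Membership.Propositional using (_∈_)
open import Data.Product using (Σ; _×_; _,_; ∃)
open import Relation.Binary.PropositionalEquality using (_≡_)
open import Relation.Nullary using (¬_)
open import Function.Bundles using (_⇔_)

-- Strings over an alphabet A are lists; positions are 1-indexed.

-- T[i..j] (meaningful when 1 ≤ i ≤ j ≤ |T|)
substr : {A : Set} → List A → ℕ → ℕ → List A
substr T i j = take (suc j ∸ i) (drop (i ∸ 1) T)

ValidInterval : {A : Set} → List A → ℕ → ℕ → Set
ValidInterval T i j = (1 ≤ i) × (i ≤ j) × (j ≤ length T)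

Palindrome : {A : Set} → List A → Set
Palindrome w = w ≡ reverse w

OccursAt : {A : Set} → List A → List A → ℕ → Set
OccursAt T w k = (1 ≤ k) × (k ∸ 1 + length w ≤ length T) × (take (length w) (drop (k ∸ 1) T) ≡ w)

-- w occurs exactly once in T (the empty string is by convention not unique)
UniqueIn : {A : Set} → List A → List A → Set
UniqueIn T w = (1 ≤ length w) × Σ ℕ (λ k → OccursAt T w k × (∀ k′ → OccursAt T w k′ → k′ ≡ k))

IsSUPS : {A : Set} → List A → ℕ → ℕ → ℕ × ℕ → Set
IsSUPS T p q (i , j) =
  ValidInterval T i j × (i ≤ p) × (q ≤ j) ×
  Palindrome (substr T i j) × UniqueIn T (substr T i j) ×
  (∀ i′ j′ → ValidInterval T i′ j′ → i′ ≤ p → q ≤ j′ →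
     suc j′ ∸ i′ < suc j ∸ i →
     Palindrome (substr T i′ j′) → ¬ UniqueIn T (substr T i′ j′))

AtMost : {B : Set} → ℕ → (B → Set) → Set
AtMost {B} k P = (L : List B) → Unique L → All P L → length L ≤ k

HasCard : {B : Set} → ℕ → (B → Set) → Set
HasCard {B} k P = Σ (List B) (λ L → Unique L × (length L ≡ k) × (∀ x → (x ∈ L) ⇔ P x))

{-# OPTIONS --safe #-}

-- All SUPSs for [p, q] have the same length ℓ, and distinct ones start at distinct positions.
-- Split them according to whether their centre lies left or right of the centre of [p, q].
-- Within one side every SUPS starts no later than the centre of any other, so three of them
-- would be palindromes of length ℓ starting at s < s + d₁ < s + d₁ + d₂ with 2(d₁ + d₂) < ℓ.
-- Consecutive palindromes give the periods 2d₁ and 2d₂, the periodicity lemma combines them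
-- into a period g ≤ d₁ + d₂ of the whole stretch, and so the first palindrome reoccurs g
-- positions later, contradicting its uniqueness. Hence each side holds at most two SUPSs.
-- For tightness it suffices to exhibit four SUPSs: by the bound there are no others.

module Submission where

open import Data.Empty using (⊥; ⊥-elim)
open import Data.List using (List; []; _∷_; [_]; _++_; take; drop; length; reverse; filter)
import Data.List.Properties as List
open import Data.List.Membership.Propositional using (_∈_)
import Data.List.Membership.DecPropositional as DecMembership
open import Data.List.Relation.Unary.All as All using (All; []; _∷_)
import Data.List.Relation.Unary.All.Properties as Allₚ
open import Data.List.Relation.Unary.AllPairs using ([]; _∷_)
open import Data.List.Relation.Unary.Unique.Propositional using (Unique)
import Data.List.Relation.Unary.Unique.Propositional.Properties as Uniqueₚ
open import Data.List.Relation.Unary.Unique.DecPropositional using (unique?)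
open import Data.Maybe using (Maybe; just; nothing)
open import Data.Maybe.Properties using (just-injective)
open import Data.Nat hiding (_≟_)
open import Data.Nat.Induction using (<-wellFounded)
open import Data.Nat.Properties hiding (_≟_)
import Data.Nat.Properties as ℕ
open import Data.Nat.Tactic.RingSolver using (solve-∀)
open import Data.Product using (Σ; ∃-syntax; _×_; _,_; proj₁; proj₂)
import Data.Product.Properties as Product
open import Data.Sum using (inj₁; inj₂)
open import Data.Unit using (tt)
open import Function.Bundles using (mk⇔)
open import Induction.WellFounded using (Acc; acc)
open import Relation.Binary using (DecidableEquality; tri<; tri≈; tri>)
open import Relation.Binary.PropositionalEquality hiding ([_])
open import Relation.Nullary using (Dec; ¬_; ¬?; yes; no; contradiction; _×-dec_; _→-dec_)
open import Relation.Nullary.Decidable using (map′; toWitness)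
open import Relation.Unary using (Decidable)
open import Relation.Unary.Properties using (∁?)
open import Defs

module _ {B : Set} (f : ℕ → B) where

  PeriodOn : ℕ → ℕ → ℕ → Set
  PeriodOn g a e = ∀ x → a ≤ x → x + g < e → f x ≡ f (x + g)

  PalindromeOn : ℕ → ℕ → Set
  PalindromeOn s ℓ = ∀ t u → suc (t + u) ≡ ℓ → f (s + t) ≡ f (s + u)

  PeriodOn-mono : ∀ {g a a′ e e′} → a ≤ a′ → e′ ≤ e → PeriodOn g a e → PeriodOn g a′ e′
  PeriodOn-mono a≤a′ e′≤e P x a′≤x x+g<e′ = P x (≤-trans a≤a′ a′≤x) (<-≤-trans x+g<e′ e′≤e)

  -- Reflecting about the centre of one palindrome and then of the other translates by 2d.
  palindromes⇒period : ∀ {s d ℓ} → PalindromeOn s ℓ → PalindromeOn (s + d) ℓ → PeriodOn (d + d) s (s + d + ℓ)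
  palindromes⇒period {s} {d} {ℓ} P₁ P₂ x s≤x x+2d<e with m≤n⇒∃[o]m+o≡n s≤x
  ... | t , refl =
    reflect-twice (m≤n⇒∃[o]m+o≡n (+-cancelˡ-< (s + d) (t + d) ℓ (subst (_< s + d + ℓ) (shuffle s t d) x+2d<e)))
    where
    open ≡-Reasoning
    shuffle : ∀ s t d → s + t + (d + d) ≡ s + d + (t + d)
    shuffle = solve-∀
    reflect-twice : ∃[ v ] suc (t + d) + v ≡ ℓ → f (s + t) ≡ f (s + t + (d + d))
    reflect-twice (v , ℓ≡) = begin
      f (s + t)             ≡⟨ P₁ t (d + v) (trans (cong suc (sym (+-assoc t d v))) ℓ≡) ⟩
      f (s + (d + v))       ≡⟨ cong f (sym (+-assoc s d v)) ⟩
      f (s + d + v)         ≡⟨ P₂ v (t + d) (trans (cong suc (+-comm v (t + d))) ℓ≡) ⟩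
      f (s + d + (t + d))   ≡⟨ cong f (sym (shuffle s t d)) ⟩
      f (s + t + (d + d))   ∎

  period-difference : ∀ {p r a e} → PeriodOn p a (p + e) → PeriodOn (p + r) a (p + e) → PeriodOn r a e
  period-difference {p} {r} {e = e} Pp Pq x a≤x x+r<e = begin
    f x              ≡⟨ Pq x a≤x (subst (_< p + e) (sym (shuffle x p r)) x+r+p<p+e) ⟩
    f (x + (p + r))  ≡⟨ cong f (shuffle x p r) ⟩
    f (x + r + p)    ≡⟨ sym (Pp (x + r) (≤-trans a≤x (m≤m+n x r)) x+r+p<p+e) ⟩
    f (x + r)        ∎
    where
    open ≡-Reasoning
    shuffle : ∀ x p r → x + (p + r) ≡ x + r + p
    shuffle = solve-∀
    x+r+p<p+e : x + r + p < p + e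
    x+r+p<p+e = subst (x + r + p <_) (+-comm e p) (+-monoˡ-< p x+r<e)

  period-stepʳ : ∀ {P g a e e′} → PeriodOn P a e′ → PeriodOn g a e → a + (P + g) ≤ e → e′ ≤ e + P →
                 PeriodOn g a e′
  period-stepʳ {P} {g} {a} {e} {e′} PP Pg a+P+g≤e e′≤e+P x a≤x x+g<e′ with x + g <? e
  ... | yes x+g<e = Pg x a≤x x+g<e
  ... | no x+g≮e
    with m≤n⇒∃[o]m+o≡n (+-cancelʳ-≤ g (a + P) x (subst (_≤ x + g) (sym (+-assoc a P g)) (≤-trans a+P+g≤e (≮⇒≥ x+g≮e))))
  ...   | y′ , refl = begin
    f (a + P + y′)      ≡⟨ cong f (shuffle a P y′) ⟩
    f (y + P)           ≡⟨ sym (PP y a≤y (subst (_< e′) (shuffle a P y′) (≤-<-trans (m≤m+n _ g) x+g<e′))) ⟩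
    f y                 ≡⟨ Pg y a≤y y+g<e ⟩
    f (y + g)           ≡⟨ PP (y + g) (≤-trans a≤y (m≤m+n y g)) y+g+P<e′ ⟩
    f (y + g + P)       ≡⟨ cong f (shuffle′ a y′ g P) ⟩
    f (a + P + y′ + g)  ∎
    where
    open ≡-Reasoning
    y = a + y′
    a≤y : a ≤ y
    a≤y = m≤m+n a y′
    shuffle : ∀ a P y′ → a + P + y′ ≡ a + y′ + P
    shuffle = solve-∀
    shuffle′ : ∀ a y′ g P → a + y′ + g + P ≡ a + P + y′ + g
    shuffle′ = solve-∀
    y+g+P<e′ : y + g + P < e′
    y+g+P<e′ = subst (_< e′) (sym (shuffle′ a y′ g P)) x+g<e′
    y+g<e : y + g < e
    y+g<e = +-cancelʳ-< P (y + g) e (<-≤-trans y+g+P<e′ e′≤e+P)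

  period-extendʳ : ∀ {P g a e} e′ → 1 ≤ P → PeriodOn P a e′ → PeriodOn g a e → a + (P + g) ≤ e → PeriodOn g a e′
  period-extendʳ {e = e} e′ 1≤P PP Pg bound with e′ ≤? e
  ... | yes e′≤e = PeriodOn-mono ≤-refl e′≤e Pg
  period-extendʳ zero 1≤P PP Pg bound | no 0≰e = contradiction z≤n 0≰e
  period-extendʳ {P} {e = e} (suc e″) 1≤P PP Pg bound | no e′≰e =
    period-stepʳ PP (period-extendʳ e″ 1≤P (PeriodOn-mono ≤-refl (n≤1+n e″) PP) Pg bound) (≤-trans bound e≤e″)
      (subst (_≤ e″ + P) (+-comm e″ 1) (+-monoʳ-≤ e″ 1≤P))
    where
    e≤e″ : e ≤ e″
    e≤e″ = ≤-pred (≰⇒> e′≰e)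

  period-stepˡ : ∀ {P g a m e} → PeriodOn P a e → PeriodOn g m e → m + (P + g) ≤ e → m ≤ a + P → PeriodOn g a e
  period-stepˡ {P} {g} {m = m} {e} PP Pg m+P+g≤e m≤a+P x a≤x x+g<e with m ≤? x
  ... | yes m≤x = Pg x m≤x x+g<e
  ... | no m≰x = begin
    f x            ≡⟨ PP x a≤x (≤-<-trans (m≤m+n (x + P) g) x+P+g<e) ⟩
    f (x + P)      ≡⟨ Pg (x + P) (≤-trans m≤a+P (+-monoˡ-≤ P a≤x)) x+P+g<e ⟩
    f (x + P + g)  ≡⟨ cong f (swap x P g) ⟩
    f (x + g + P)  ≡⟨ sym (PP (x + g) (≤-trans a≤x (m≤m+n x g)) (subst (_< e) (swap x P g) x+P+g<e)) ⟩
    f (x + g)      ∎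
    where
    open ≡-Reasoning
    swap : ∀ x P g → x + P + g ≡ x + g + P
    swap = solve-∀
    x+P+g<e : x + P + g < e
    x+P+g<e = subst (_< e) (sym (+-assoc x P g)) (<-≤-trans (+-monoˡ-< (P + g) (≰⇒> m≰x)) m+P+g≤e)

  period-extendˡ : ∀ {P g a e} m → 1 ≤ P → PeriodOn P a e → PeriodOn g m e → m + (P + g) ≤ e → PeriodOn g a e
  period-extendˡ {a = a} m 1≤P PP Pg bound with m ≤? a
  ... | yes m≤a = PeriodOn-mono m≤a ≤-refl Pg
  period-extendˡ zero 1≤P PP Pg bound | no 0≰a = contradiction z≤n 0≰a
  period-extendˡ {P} {a = a} (suc m) 1≤P PP Pg bound | no m′≰a =
    period-extendˡ m 1≤P PP
      (period-stepˡ (PeriodOn-mono a≤m ≤-refl PP) Pg bound (subst (_≤ m + P) (+-comm m 1) (+-monoʳ-≤ m 1≤P)))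
      (≤-trans (n≤1+n _) bound)
    where
    a≤m : a ≤ m
    a≤m = ≤-pred (≰⇒> m′≰a)

  period-union : ∀ {g a m e₁ e₂} → PeriodOn g a e₁ → PeriodOn g m e₂ → m + g ≤ e₁ → PeriodOn g a e₂
  period-union {g} {e₁ = e₁} P₁ P₂ m+g≤e₁ x a≤x x+g<e₂ with x + g <? e₁
  ... | yes x+g<e₁ = P₁ x a≤x x+g<e₁
  ... | no x+g≮e₁ = P₂ x (+-cancelʳ-≤ g _ x (≤-trans m+g≤e₁ (≮⇒≥ x+g≮e₁))) x+g<e₂

  PeriodBelow : ℕ → ℕ → ℕ → ℕ → Set
  PeriodBelow p q a e = ∃[ g ] 1 ≤ g × g ≤ p × g ≤ q × PeriodOn g a e

  -- The weak form of the Fine–Wilf theorem, proved by Euclid's subtraction algorithm.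
  periodicity-lemma : ∀ {p q a e} → 1 ≤ p → 1 ≤ q → a + (p + q) ≤ e → PeriodOn p a e → PeriodOn q a e →
                      PeriodBelow p q a e
  periodicity-lemma {p} {q} = periodicity (<-wellFounded (p + q))
    where
    periodicity : ∀ {p q a e} → Acc _<_ (p + q) → 1 ≤ p → 1 ≤ q → a + (p + q) ≤ e →
                  PeriodOn p a e → PeriodOn q a e → PeriodBelow p q a e
    periodicity-< : ∀ {p q a e n} → Acc _<_ n → p + q ≡ n → p < q → 1 ≤ p → a + (p + q) ≤ e →
                    PeriodOn p a e → PeriodOn q a e → PeriodBelow p q a e

    periodicity {p} {q} {a} {e} rec 1≤p 1≤q bound Pp Pq with <-cmp p q
    ... | tri≈ _ refl _ = p , 1≤p , ≤-refl , ≤-refl , Pp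
    ... | tri< p<q _ _ = periodicity-< rec refl p<q 1≤p bound Pp Pq
    ... | tri> _ _ q<p with periodicity-< rec (+-comm q p) q<p 1≤q
                              (subst (λ n → a + n ≤ e) (+-comm p q) bound) Pq Pp
    ...   | g , 1≤g , g≤q , g≤p , Pg = g , 1≤g , g≤p , g≤q , Pg

    periodicity-< {p} {a = a} (acc rs) p+q≡n p<q 1≤p bound Pp Pq
      with m≤n⇒∃[o]m+o≡n (<⇒≤ p<q) | m≤n⇒∃[o]m+o≡n (≤-trans (≤-trans (m≤m+n p _) (m≤n+m _ a)) bound)
    ... | r , refl | e′ , refl =
      extend (periodicity (rs (subst (p + r <_) p+q≡n (m<n+m (p + r) 1≤p))) 1≤p 1≤r bound′
                (PeriodOn-mono ≤-refl (m≤n+m e′ p) Pp) (period-difference Pp Pq))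
      where
      1≤r : 1 ≤ r
      1≤r = +-cancelˡ-< p 0 r (subst (_< p + r) (sym (+-identityʳ p)) p<q)
      regroup : ∀ a p r → a + (p + (p + r)) ≡ p + (a + (p + r))
      regroup = solve-∀
      bound′ : a + (p + r) ≤ e′
      bound′ = +-cancelˡ-≤ p _ _ (subst (_≤ p + e′) (regroup a p r) bound)
      extend : PeriodBelow p r a e′ → PeriodBelow p (p + r) a (p + e′)
      extend (g , 1≤g , g≤p , g≤r , Pg) =
        g , 1≤g , g≤p , ≤-trans g≤r (m≤n+m r p) ,
        period-stepʳ Pp Pg (≤-trans (+-monoʳ-≤ a (+-monoʳ-≤ p g≤r)) bound′) (≤-reflexive (+-comm p e′))

  PeriodOn⇒shift : ∀ {g s ℓ e} → s + g + ℓ ≤ e → PeriodOn g s e → ∀ t → t < ℓ → f (s + t) ≡ f (s + g + t)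
  PeriodOn⇒shift {g} {s} {e = e} room P t t<ℓ =
    trans (P (s + t) (m≤m+n s t) (subst (_< e) (swap s g t) (<-≤-trans (+-monoʳ-< (s + g) t<ℓ) room)))
          (cong f (sym (swap s g t)))
    where
    swap : ∀ s g t → s + g + t ≡ s + t + g
    swap = solve-∀

  -- The periods 2d₁ and 2d₂ both hold on the middle palindrome, which is long enough for the
  -- periodicity lemma; the resulting period then spreads to the outer palindromes.
  three-palindromes⇒period : ∀ {s d₁ d₂ ℓ} → 1 ≤ d₁ → 1 ≤ d₂ → (d₁ + d₁) + (d₂ + d₂) ≤ ℓ →
    PalindromeOn s ℓ → PalindromeOn (s + d₁) ℓ → PalindromeOn (s + d₁ + d₂) ℓ →
    ∃[ g ] 1 ≤ g × g ≤ d₁ + d₂ × PeriodOn g s (s + d₁ + d₂ + ℓ)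
  three-palindromes⇒period {s} {d₁} {d₂} {ℓ} 1≤d₁ 1≤d₂ 2d≤ℓ X₁ X₂ X₃ =
    spread (periodicity-lemma 1≤2d₁ 1≤2d₂ (+-monoʳ-≤ m 2d≤ℓ)
              (PeriodOn-mono (m≤m+n s d₁) ≤-refl P₁) (PeriodOn-mono ≤-refl (+-monoˡ-≤ ℓ (m≤m+n m d₂)) P₂))
    where
    m = s + d₁
    1≤2d₁ : 1 ≤ d₁ + d₁
    1≤2d₁ = ≤-trans 1≤d₁ (m≤m+n d₁ d₁)
    1≤2d₂ : 1 ≤ d₂ + d₂
    1≤2d₂ = ≤-trans 1≤d₂ (m≤m+n d₂ d₂)
    P₁ : PeriodOn (d₁ + d₁) s (m + ℓ)
    P₁ = palindromes⇒period X₁ X₂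
    P₂ : PeriodOn (d₂ + d₂) m (m + d₂ + ℓ)
    P₂ = palindromes⇒period X₂ X₃
    spread : PeriodBelow (d₁ + d₁) (d₂ + d₂) m (m + ℓ) → ∃[ g ] 1 ≤ g × g ≤ d₁ + d₂ × PeriodOn g s (m + d₂ + ℓ)
    spread (g , 1≤g , g≤2d₁ , g≤2d₂ , Pg) =
      g , 1≤g , g≤d₁+d₂ ,
      period-union (period-extendˡ m 1≤2d₁ P₁ Pg (+-monoʳ-≤ m 2d₁+g≤ℓ))
                   (period-extendʳ (m + d₂ + ℓ) 1≤2d₂ P₂ Pg (+-monoʳ-≤ m 2d₂+g≤ℓ))
                   (+-monoʳ-≤ m (≤-trans (m≤n+m g (d₁ + d₁)) 2d₁+g≤ℓ))
      where
      2d₁+g≤ℓ : (d₁ + d₁) + g ≤ ℓ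
      2d₁+g≤ℓ = ≤-trans (+-monoʳ-≤ (d₁ + d₁) g≤2d₂) 2d≤ℓ
      2d₂+g≤ℓ : (d₂ + d₂) + g ≤ ℓ
      2d₂+g≤ℓ = ≤-trans (subst (_≤ (d₁ + d₁) + (d₂ + d₂)) (+-comm g (d₂ + d₂)) (+-monoˡ-≤ (d₂ + d₂) g≤2d₁))
                        2d≤ℓ
      g≤d₁+d₂ : g ≤ d₁ + d₂
      g≤d₁+d₂ with ≤-total d₁ d₂
      ... | inj₁ d₁≤d₂ = ≤-trans g≤2d₁ (+-monoʳ-≤ d₁ d₁≤d₂)
      ... | inj₂ d₂≤d₁ = ≤-trans g≤2d₂ (+-monoˡ-≤ d₂ d₂≤d₁)

module _ {A : Set} where

  _‼_ : List A → ℕ → Maybe A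
  []       ‼ _     = nothing
  (x ∷ xs) ‼ zero  = just x
  (x ∷ xs) ‼ suc k = xs ‼ k

  window : List A → ℕ → ℕ → List A
  window T s ℓ = take ℓ (drop s T)

  ‼-drop : ∀ s (T : List A) t → drop s T ‼ t ≡ T ‼ (s + t)
  ‼-drop zero    T        t = refl
  ‼-drop (suc s) []       t = refl
  ‼-drop (suc s) (x ∷ T)  t = ‼-drop s T t

  ‼-take : ∀ m (xs : List A) {t} → t < m → take m xs ‼ t ≡ xs ‼ t
  ‼-take (suc m) []       _       = refl
  ‼-take (suc m) (x ∷ xs) {zero}  _       = refl
  ‼-take (suc m) (x ∷ xs) {suc t} (s≤s t<m) = ‼-take m xs t<m

  ‼-++ˡ : ∀ (xs ys : List A) {t} → t < length xs → (xs ++ ys) ‼ t ≡ xs ‼ t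
  ‼-++ˡ (x ∷ xs) ys {zero}  _         = refl
  ‼-++ˡ (x ∷ xs) ys {suc t} (s≤s t<n) = ‼-++ˡ xs ys t<n

  ‼-++-length : ∀ (xs : List A) y ys → (xs ++ y ∷ ys) ‼ length xs ≡ just y
  ‼-++-length []       y ys = refl
  ‼-++-length (x ∷ xs) y ys = ‼-++-length xs y ys

  ‼-reverse : ∀ (w : List A) t u → suc (t + u) ≡ length w → reverse w ‼ t ≡ w ‼ u
  ‼-reverse (x ∷ xs) t zero t+1≡n = begin
    reverse (x ∷ xs) ‼ t              ≡⟨ cong (_‼ t) (List.unfold-reverse x xs) ⟩
    (reverse xs ++ [ x ]) ‼ t         ≡⟨ cong ((reverse xs ++ [ x ]) ‼_) t≡n ⟩
    (reverse xs ++ [ x ]) ‼ length (reverse xs) ≡⟨ ‼-++-length (reverse xs) x [] ⟩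
    just x                            ∎
    where
    open ≡-Reasoning
    t≡n : t ≡ length (reverse xs)
    t≡n = trans (sym (+-identityʳ t)) (trans (suc-injective t+1≡n) (sym (List.length-reverse xs)))
  ‼-reverse (x ∷ xs) t (suc u) t+u+2≡n = begin
    reverse (x ∷ xs) ‼ t       ≡⟨ cong (_‼ t) (List.unfold-reverse x xs) ⟩
    (reverse xs ++ [ x ]) ‼ t  ≡⟨ ‼-++ˡ (reverse xs) [ x ] (subst (t <_) (sym (List.length-reverse xs)) t<n) ⟩
    reverse xs ‼ t             ≡⟨ ‼-reverse xs t u t+u+1≡n ⟩
    xs ‼ u                     ∎
    where
    open ≡-Reasoning
    t+u+1≡n : suc (t + u) ≡ length xs
    t+u+1≡n = suc-injective (trans (cong suc (sym (+-suc t u))) t+u+2≡n)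
    t<n : t < length xs
    t<n = ≤-trans (s≤s (m≤m+n t u)) (≤-reflexive t+u+1≡n)

  take-‼-ext : ∀ ℓ (xs ys : List A) → (∀ t → t < ℓ → xs ‼ t ≡ ys ‼ t) → take ℓ xs ≡ take ℓ ys
  take-‼-ext zero    xs       ys       _ = refl
  take-‼-ext (suc ℓ) []       []       _ = refl
  take-‼-ext (suc ℓ) []       (y ∷ ys) h with () ← h 0 (s≤s z≤n)
  take-‼-ext (suc ℓ) (x ∷ xs) []       h with () ← h 0 (s≤s z≤n)
  take-‼-ext (suc ℓ) (x ∷ xs) (y ∷ ys) h =
    cong₂ _∷_ (just-injective (h 0 (s≤s z≤n))) (take-‼-ext ℓ xs ys (λ t t<ℓ → h (suc t) (s≤s t<ℓ)))

  length-window : ∀ {T : List A} {s ℓ} → s + ℓ ≤ length T → length (window T s ℓ) ≡ ℓ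
  length-window {T} {s} {ℓ} s+ℓ≤n = begin
    length (take ℓ (drop s T))  ≡⟨ List.length-take ℓ (drop s T) ⟩
    ℓ ⊓ length (drop s T)      ≡⟨ cong (ℓ ⊓_) (List.length-drop s T) ⟩
    ℓ ⊓ (length T ∸ s)         ≡⟨ m≤n⇒m⊓n≡m (m+n≤o⇒m≤o∸n ℓ (subst (_≤ length T) (+-comm s ℓ) s+ℓ≤n)) ⟩
    ℓ                          ∎
    where open ≡-Reasoning

  palindrome⇒PalindromeOn : ∀ {T : List A} {s ℓ} → s + ℓ ≤ length T → Palindrome (window T s ℓ) →
                            PalindromeOn (T ‼_) s ℓ
  palindrome⇒PalindromeOn {T} {s} {ℓ} s+ℓ≤n pal t u t+u+1≡ℓ = begin
    T ‼ (s + t)        ≡⟨ sym (‼-drop s T t) ⟩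
    drop s T ‼ t       ≡⟨ sym (‼-take ℓ (drop s T) t<ℓ) ⟩
    w ‼ t              ≡⟨ cong (_‼ t) pal ⟩
    reverse w ‼ t      ≡⟨ ‼-reverse w t u (trans t+u+1≡ℓ (sym (length-window s+ℓ≤n))) ⟩
    w ‼ u              ≡⟨ ‼-take ℓ (drop s T) u<ℓ ⟩
    drop s T ‼ u       ≡⟨ ‼-drop s T u ⟩
    T ‼ (s + u)        ∎
    where
    open ≡-Reasoning
    w = window T s ℓ
    t<ℓ : t < ℓ
    t<ℓ = ≤-trans (s≤s (m≤m+n t u)) (≤-reflexive t+u+1≡ℓ)
    u<ℓ : u < ℓ
    u<ℓ = ≤-trans (s≤s (m≤n+m u t)) (≤-reflexive t+u+1≡ℓ)

  window-occurs : ∀ {T : List A} {s ℓ} → s + ℓ ≤ length T → OccursAt T (window T s ℓ) (suc s)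
  window-occurs {T} {s} {ℓ} s+ℓ≤n =
    s≤s z≤n , subst (λ n → s + n ≤ length T) (sym |w|≡ℓ) s+ℓ≤n , cong (λ n → take n (drop s T)) |w|≡ℓ
    where
    |w|≡ℓ : length (window T s ℓ) ≡ ℓ
    |w|≡ℓ = length-window s+ℓ≤n

  shift⇒¬UniqueIn : ∀ {T : List A} {s g ℓ} → 1 ≤ g → s + g + ℓ ≤ length T →
                    (∀ t → t < ℓ → T ‼ (s + t) ≡ T ‼ (s + g + t)) → ¬ UniqueIn T (window T s ℓ)
  shift⇒¬UniqueIn {T} {s} {g} {ℓ} 1≤g s+g+ℓ≤n shift (_ , k , _ , only-k) =
    <⇒≢ (m<m+n s 1≤g) (suc-injective (trans (only-k (suc s) first) (sym (only-k (suc (s + g)) second))))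
    where
    first : OccursAt T (window T s ℓ) (suc s)
    first = window-occurs (≤-trans (+-monoˡ-≤ ℓ (m≤m+n s g)) s+g+ℓ≤n)
    same : window T (s + g) ℓ ≡ window T s ℓ
    same = take-‼-ext ℓ (drop (s + g) T) (drop s T) λ t t<ℓ →
      trans (‼-drop (s + g) T t) (trans (sym (shift t t<ℓ)) (sym (‼-drop s T t)))
    second : OccursAt T (window T s ℓ) (suc (s + g))
    second = subst (λ w → OccursAt T w (suc (s + g))) same (window-occurs s+g+ℓ≤n)

  three-palindromes⇒¬UniqueIn : ∀ {T : List A} {s d₁ d₂ ℓ} → 1 ≤ d₁ → 1 ≤ d₂ → (d₁ + d₁) + (d₂ + d₂) ≤ ℓ →
    s + d₁ + d₂ + ℓ ≤ length T →
    Palindrome (window T s ℓ) → Palindrome (window T (s + d₁) ℓ) → Palindrome (window T (s + d₁ + d₂) ℓ) →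
    ¬ UniqueIn T (window T s ℓ)
  three-palindromes⇒¬UniqueIn {T} {s} {d₁} {d₂} {ℓ} 1≤d₁ 1≤d₂ 2d≤ℓ fits pal₁ pal₂ pal₃
    with three-palindromes⇒period (T ‼_) 1≤d₁ 1≤d₂ 2d≤ℓ
           (palindrome⇒PalindromeOn (within s (≤-trans (m≤m+n s d₁) (m≤m+n _ d₂))) pal₁)
           (palindrome⇒PalindromeOn (within (s + d₁) (m≤m+n _ d₂)) pal₂)
           (palindrome⇒PalindromeOn fits pal₃)
    where
    within : ∀ s′ → s′ ≤ s + d₁ + d₂ → s′ + ℓ ≤ length T
    within s′ s′≤ = ≤-trans (+-monoˡ-≤ ℓ s′≤) fits
  ... | g , 1≤g , g≤d , Pg =
    shift⇒¬UniqueIn 1≤g (≤-trans room fits) (PeriodOn⇒shift (T ‼_) room Pg)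
    where
    room : s + g + ℓ ≤ s + d₁ + d₂ + ℓ
    room = +-monoˡ-≤ ℓ (subst (s + g ≤_) (sym (+-assoc s d₁ d₂)) (+-monoʳ-≤ s g≤d))

module _ {B : Set} where

  length-filter+length-filter-∁ : ∀ {Q : B → Set} (Q? : Decidable Q) xs →
    length (filter Q? xs) + length (filter (∁? Q?) xs) ≡ length xs
  length-filter+length-filter-∁ Q? []       = refl
  length-filter+length-filter-∁ Q? (x ∷ xs) with Q? x
  ... | yes _ = cong suc (length-filter+length-filter-∁ Q? xs)
  ... | no  _ = trans (+-suc _ _) (cong suc (length-filter+length-filter-∁ Q? xs))

  AtMost-split : ∀ {m n} {P Q : B → Set} → Decidable Q →
    AtMost m (λ x → P x × Q x) → AtMost n (λ x → P x × ¬ Q x) → AtMost (m + n) P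
  AtMost-split {m} {n} {P} Q? atMost-Q atMost-∁Q L uniq all-P = begin
    length L                                          ≡⟨ sym (length-filter+length-filter-∁ Q? L) ⟩
    length (filter Q? L) + length (filter (∁? Q?) L)  ≤⟨ +-mono-≤ (part Q? atMost-Q) (part (∁? Q?) atMost-∁Q) ⟩
    m + n                                             ∎
    where
    open ≤-Reasoning
    part : ∀ {R k} (R? : Decidable R) → AtMost k (λ x → P x × R x) → length (filter R? L) ≤ k
    part R? atMost =
      atMost (filter R? L) (Uniqueₚ.filter⁺ R? uniq) (All.zip (Allₚ.filter⁺ R? all-P , Allₚ.all-filter R? L))

  no-increasing-triple⇒no-triple : ∀ {P : B → Set} (key : B → ℕ) →
    (∀ {x y} → P x → P y → key x ≡ key y → x ≡ y) →
    (∀ {x y z} → P x → P y → P z → key x < key y → key y < key z → ⊥) →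
    ∀ {x y z} → P x → P y → P z → x ≢ y → x ≢ z → y ≢ z → ⊥
  no-increasing-triple⇒no-triple key inj chain {x} {y} {z} Px Py Pz x≢y x≢z y≢z
    with <-cmp (key x) (key y) | <-cmp (key x) (key z) | <-cmp (key y) (key z)
  ... | tri≈ _ x≈y _ | _            | _            = x≢y (inj Px Py x≈y)
  ... | _            | tri≈ _ x≈z _ | _            = x≢z (inj Px Pz x≈z)
  ... | _            | _            | tri≈ _ y≈z _ = y≢z (inj Py Pz y≈z)
  ... | tri< x<y _ _ | _            | tri< y<z _ _ = chain Px Py Pz x<y y<z
  ... | tri< x<y _ _ | tri< x<z _ _ | tri> _ _ z<y = chain Px Pz Py x<z z<y
  ... | tri< x<y _ _ | tri> _ _ z<x | tri> _ _ _   = chain Pz Px Py z<x x<y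
  ... | tri> _ _ y<x | tri< x<z _ _ | _            = chain Py Px Pz y<x x<z
  ... | tri> _ _ _   | tri> _ _ z<x | tri< y<z _ _ = chain Py Pz Px y<z z<x
  ... | tri> _ _ y<x | _            | tri> _ _ z<y = chain Pz Py Px z<y y<x

  no-increasing-triple⇒AtMost-2 : ∀ {P : B → Set} (key : B → ℕ) →
    (∀ {x y} → P x → P y → key x ≡ key y → x ≡ y) →
    (∀ {x y z} → P x → P y → P z → key x < key y → key y < key z → ⊥) →
    AtMost 2 P
  no-increasing-triple⇒AtMost-2 key inj chain []          _ _ = z≤n
  no-increasing-triple⇒AtMost-2 key inj chain (_ ∷ [])     _ _ = s≤s z≤n
  no-increasing-triple⇒AtMost-2 key inj chain (_ ∷ _ ∷ []) _ _ = s≤s (s≤s z≤n)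
  no-increasing-triple⇒AtMost-2 key inj chain (_ ∷ _ ∷ _ ∷ _)
    ((x≢y ∷ x≢z ∷ _) ∷ (y≢z ∷ _) ∷ _) (Px ∷ Py ∷ Pz ∷ _) =
    ⊥-elim (no-increasing-triple⇒no-triple key inj chain Px Py Pz x≢y x≢z y≢z)

  AtMost⇒HasCard : ∀ {P : B → Set} → DecidableEquality B → (L : List B) → Unique L → All P L →
    AtMost (length L) P → HasCard (length L) P
  AtMost⇒HasCard {P} _≟_ L uniq all-P atMost = L , uniq , refl , λ x → mk⇔ (All.lookup all-P) (member x)
    where
    member : ∀ x → P x → x ∈ L
    member x Px with DecMembership._∈?_ _≟_ x L
    ... | yes x∈L = x∈L
    ... | no  x∉L = contradiction (atMost (x ∷ L) (Allₚ.¬Any⇒All¬ L x∉L ∷ uniq) (Px ∷ all-P)) (<-irrefl refl)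

m<n⇒∃[o]n≡m+o : ∀ {m n} → m < n → ∃[ o ] 1 ≤ o × n ≡ m + o
m<n⇒∃[o]n≡m+o {m} m<n with m≤n⇒∃[o]m+o≡n m<n
... | o , refl = suc o , s≤s z≤n , sym (+-suc m o)

width : ℕ × ℕ → ℕ
width (i , j) = suc j ∸ i

module _ {A : Set} {T : List A} {p q : ℕ} where

  SUPS-minimal : ∀ {x y} → IsSUPS T p q x → IsSUPS T p q y → ¬ width x < width y
  SUPS-minimal {i , j} (valid , i≤p , q≤j , pal , uniq , _) (_ , _ , _ , _ , _ , shortest) =
    λ shorter → shortest i j valid i≤p q≤j shorter pal uniq

  SUPS-width-unique : ∀ {x y} → IsSUPS T p q x → IsSUPS T p q y → width x ≡ width y
  SUPS-width-unique Sx Sy = ≤-antisym (≮⇒≥ (SUPS-minimal Sy Sx)) (≮⇒≥ (SUPS-minimal Sx Sy))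

  SUPS-end : ∀ {i j} → IsSUPS T p q (i , j) → i + width (i , j) ≡ suc j
  SUPS-end ((_ , i≤j , _) , _) = m+[n∸m]≡n (m≤n⇒m≤1+n i≤j)

  SUPS-start-injective : ∀ {x y} → IsSUPS T p q x → IsSUPS T p q y → proj₁ x ≡ proj₁ y → x ≡ y
  SUPS-start-injective {i , j} {.i , j′} Sx Sy refl = cong (i ,_) (suc-injective (begin
    suc j               ≡⟨ SUPS-end Sx ⟨
    i + width (i , j)   ≡⟨ cong (i +_) (SUPS-width-unique Sx Sy) ⟩
    i + width (i , j′)  ≡⟨ SUPS-end Sy ⟩
    suc j′              ∎))
    where open ≡-Reasoning

  SUPS-fits : ∀ {s j} → IsSUPS T p q (suc s , j) → s + width (suc s , j) ≤ length T
  SUPS-fits S@((_ , _ , j≤n) , _) = ≤-trans (≤-reflexive (suc-injective (SUPS-end S))) j≤n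

  no-three-close-SUPS : ∀ {i₁ j₁ i₂ j₂ i₃ j₃} →
    IsSUPS T p q (i₁ , j₁) → IsSUPS T p q (i₂ , j₂) → IsSUPS T p q (i₃ , j₃) →
    i₁ < i₂ → i₂ < i₃ → i₃ + i₃ ≤ i₁ + j₁ → ⊥
  no-three-close-SUPS {zero} ((() , _) , _) _ _ _ _ _
  no-three-close-SUPS {suc s} {j₁}
    S₁@(_ , _ , _ , pal₁ , uniq₁ , _) S₂@(_ , _ , _ , pal₂ , _) S₃@(_ , _ , _ , pal₃ , _) i₁<i₂ i₂<i₃ close
    with m<n⇒∃[o]n≡m+o i₁<i₂
  ... | d₁ , 1≤d₁ , refl with m<n⇒∃[o]n≡m+o i₂<i₃
  ... | d₂ , 1≤d₂ , refl =
    three-palindromes⇒¬UniqueIn 1≤d₁ 1≤d₂ room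
      (subst (λ ℓ → s + d₁ + d₂ + ℓ ≤ length T) ℓ₃≡ℓ (SUPS-fits S₃))
      pal₁
      (subst (λ ℓ → Palindrome (window T (s + d₁) ℓ)) ℓ₂≡ℓ pal₂)
      (subst (λ ℓ → Palindrome (window T (s + d₁ + d₂) ℓ)) ℓ₃≡ℓ pal₃)
      uniq₁
    where
    ℓ = width (suc s , j₁)
    ℓ₂≡ℓ = SUPS-width-unique S₂ S₁
    ℓ₃≡ℓ = SUPS-width-unique S₃ S₁
    regroup : ∀ s d₁ d₂ → suc (s + d₁ + d₂) + suc (s + d₁ + d₂) ≡ (suc s + s) + suc ((d₁ + d₁) + (d₂ + d₂))
    regroup = solve-∀
    i₁+j₁≡ : suc s + j₁ ≡ (suc s + s) + ℓ
    i₁+j₁≡ = trans (cong (suc s +_) (sym (suc-injective (SUPS-end S₁)))) (sym (+-assoc (suc s) s ℓ))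
    room : (d₁ + d₁) + (d₂ + d₂) ≤ ℓ
    room = <⇒≤ (+-cancelˡ-≤ (suc s + s) _ _ (subst₂ _≤_ (regroup s d₁ d₂) i₁+j₁≡ close))

  left-centred-close : ∀ {i j i′ j′} → p ≤ q → IsSUPS T p q (i , j) → IsSUPS T p q (i′ , j′) →
    i′ + j′ ≤ p + q → i′ + i′ ≤ i + j
  left-centred-close {i} {j} {i′} {j′} p≤q S@(_ , _ , q≤j , _) S′ centred = +-cancelʳ-≤ w _ _ (begin
    i′ + i′ + w         ≡⟨ +-assoc i′ i′ w ⟩
    i′ + (i′ + w)       ≡⟨ cong (i′ +_) (trans (cong (i′ +_) (sym w′≡w)) (SUPS-end S′)) ⟩
    i′ + suc j′         ≡⟨ +-suc i′ j′ ⟩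
    suc (i′ + j′)       ≤⟨ s≤s centred ⟩
    suc (p + q)         ≤⟨ s≤s (+-mono-≤ (≤-trans p≤q q≤j) q≤j) ⟩
    suc (j + j)         ≡⟨ +-suc j j ⟨
    j + suc j           ≡⟨ cong (j +_) (SUPS-end S) ⟨
    j + (i + w)         ≡⟨ regroup j i w ⟩
    i + j + w           ∎)
    where
    open ≤-Reasoning
    w = width (i , j)
    w′≡w = SUPS-width-unique S′ S
    regroup : ∀ j i w → j + (i + w) ≡ i + j + w
    regroup = solve-∀

  right-centred-close : ∀ {i j i′ j′} → p ≤ q → IsSUPS T p q (i′ , j′) → ¬ (i + j ≤ p + q) → i′ + i′ ≤ i + j
  right-centred-close p≤q (_ , i′≤p , _) off-centre =
    <⇒≤ (≤-<-trans (+-mono-≤ i′≤p (≤-trans i′≤p p≤q)) (≰⇒> off-centre))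

SUPS-atMost-4 : ∀ {A : Set} (T : List A) {p q} → p ≤ q → AtMost 4 (IsSUPS T p q)
SUPS-atMost-4 T {p} {q} p≤q =
  AtMost-split (λ x → proj₁ x + proj₂ x ≤? p + q)
    (no-increasing-triple⇒AtMost-2 proj₁ injective
      λ (S₁ , _) (S₂ , _) (S₃ , centred₃) i₁<i₂ i₂<i₃ →
        no-three-close-SUPS S₁ S₂ S₃ i₁<i₂ i₂<i₃ (left-centred-close p≤q S₁ S₃ centred₃))
    (no-increasing-triple⇒AtMost-2 proj₁ injective
      λ {(i₁ , j₁)} (S₁ , off-centre₁) (S₂ , _) (S₃ , _) i₁<i₂ i₂<i₃ →
        no-three-close-SUPS S₁ S₂ S₃ i₁<i₂ i₂<i₃ (right-centred-close {i = i₁} {j = j₁} p≤q S₃ off-centre₁))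
  where
  injective : ∀ {Q : ℕ × ℕ → Set} {x y} → IsSUPS T p q x × Q x → IsSUPS T p q y × Q y →
              proj₁ x ≡ proj₁ y → x ≡ y
  injective (Sx , _) (Sy , _) = SUPS-start-injective Sx Sy

module _ {A : Set} (_≟_ : DecidableEquality A) where

  palindrome? : (w : List A) → Dec (Palindrome w)
  palindrome? w = List.≡-dec _≟_ w (reverse w)

  validInterval? : ∀ (T : List A) i j → Dec (ValidInterval T i j)
  validInterval? T i j = 1 ≤? i ×-dec i ≤? j ×-dec j ≤? length T

  occursAt? : ∀ (T w : List A) k → Dec (OccursAt T w k)
  occursAt? T w k = 1 ≤? k ×-dec k ∸ 1 + length w ≤? length T ×-dec List.≡-dec _≟_ (take (length w) (drop (k ∸ 1) T)) w

  occursAt-bound : ∀ {T w : List A} {k} → OccursAt T w k → k < 2 + length T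
  occursAt-bound {k = k} (_ , fits , _) = s≤s (≤-trans (m≤n+m∸n k 1) (s≤s (m+n≤o⇒m≤o (k ∸ 1) fits)))

  uniqueIn? : ∀ (T w : List A) → Dec (UniqueIn T w)
  uniqueIn? T w =
    map′ (λ (nonempty , k , _ , occ , only) → nonempty , k , occ , λ k′ occ′ → only (occursAt-bound occ′) occ′)
         (λ (nonempty , k , occ , only) → nonempty , k , occursAt-bound occ , occ , λ {k′} _ → only k′)
         (1 ≤? length w ×-dec
          anyUpTo? (λ k → occursAt? T w k ×-dec allUpTo? (λ k′ → occursAt? T w k′ →-dec k′ ℕ.≟ k) N) N)
    where N = 2 + length T

  isSUPS? : ∀ (T : List A) p q x → Dec (IsSUPS T p q x)
  isSUPS? T p q (i , j) =
    validInterval? T i j ×-dec i ≤? p ×-dec q ≤? j ×-dec palindrome? (substr T i j) ×-dec uniqueIn? T (substr T i j) ×-dec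
    map′ (λ shortest i′ j′ valid@(_ , _ , j′≤n) i′≤p → shortest {i′} (s≤s i′≤p) {j′} (s≤s j′≤n) valid i′≤p)
         (λ shortest {i′} _ {j′} _ → shortest i′ j′)
         (allUpTo? (λ i′ → allUpTo? (λ j′ →
            validInterval? T i′ j′ →-dec i′ ≤? p →-dec q ≤? j′ →-dec suc j′ ∸ i′ <? suc j ∸ i →-dec
            palindrome? (substr T i′ j′) →-dec ¬? (uniqueIn? T (substr T i′ j′))) (suc (length T))) (suc p))

example-string : List ℕ
example-string =
  1 ∷ 0 ∷ 1 ∷ 0 ∷ 1 ∷ 0 ∷ 1 ∷ 0 ∷ 1 ∷ 0 ∷ 1 ∷ 0 ∷ 0 ∷ 0 ∷ 1 ∷ 0 ∷ 1 ∷ 0 ∷ 0 ∷ 0 ∷ 1 ∷ 0 ∷ 1 ∷ []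

example-SUPSs : List (ℕ × ℕ)
example-SUPSs = (1 , 11) ∷ (2 , 12) ∷ (8 , 18) ∷ (11 , 21) ∷ []

example-SUPSs-exact : HasCard 4 (IsSUPS example-string 11 11)
example-SUPSs-exact =
  AtMost⇒HasCard (Product.≡-dec ℕ._≟_ ℕ._≟_) example-SUPSs
    (toWitness {a? = unique? (Product.≡-dec ℕ._≟_ ℕ._≟_) example-SUPSs} tt)
    (toWitness {a? = All.all? (isSUPS? ℕ._≟_ example-string 11 11) example-SUPSs} tt)
    (SUPS-atMost-4 example-string ≤-refl)

theorem1 : ((A : Set) → (T : List A) → (p q : ℕ) → 1 ≤ length T → 1 ≤ p → p ≤ q → q ≤ length T →
                AtMost 4 (IsSUPS T p q))
             × Σ (List ℕ) (λ S → Σ ℕ (λ p → Σ ℕ (λ q →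
                 (1 ≤ p) × (p ≤ q) × (q ≤ length S) × HasCard 4 (IsSUPS S p q))))
theorem1 =
  (λ _ T _ _ _ _ p≤q _ → SUPS-atMost-4 T p≤q) ,
  example-string , 11 , 11 , s≤s z≤n , ≤-refl , m≤m+n 11 12 , example-SUPSs-exact
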